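{- Let $n$ be a positive integer and let $\langle X,\tau_X\rangle$, $\langle Y,\tau_Y\rangle$ be $(n+1)$-valued MV-topological spaces, with skeleton spaces $j(X)=\langle X,j(\tau_X)\rangle$ and $j(Y)=\langle Y,j(\tau_Y)\rangle$. Then every MV-continuous map $f:X\to Y$ is a continuous map $j(X)\to j(Y)$, i.e. $\hom_{\mathrm{MVTop}}(X,Y)\subseteq\hom_{\mathrm{Top}}(j(X),j(Y))$. Moreover, if $X$ is finite and $\tau_X=\text{Ł}_n^X$, equality holds.
   Context: An MV-topological space is a pair $\langle X,\tau\rangle$ with $\tau\subseteq[0,1]^X$ containing the constant functions $\mathbf 0,\mathbf 1$, closed under arbitrary pointwise suprema, and closed under $\oplus$ ($x\oplus y=\min\{x+y,1\}$), $\odot$ ($x\odot y=\max\{x+y-1,0\}$) and pointwise minimum of two elements. It is $(n+1)$-valued if $\tau\subseteq\text{Ł}_n^X$, where $\text{Ł}_n=\{k/n\mid k=0,\dots,n\}$. A map $f:X\to Y$ is MV-continuous if $o\circ f\in\tau_X$ for all $o\in\tau_Y$. The skeleton of $\langle X,\tau\rangle$ is the classical topological space $\langle X,j(\tau)\rangle$ where $j(\tau)=\tau\cap\{0,1\}^X$, identified with a family of subsets of $X$ via characteristic functions. -}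

module Defs where

open import Data.Nat using (ℕ; suc; _+_; _∸_; _⊓_; s≤s)
open import Data.Nat.Properties using (m⊓n≤n)
open import Data.Fin using (Fin; toℕ; fromℕ; fromℕ<; zero; _≤_)
open import Data.Bool using (Bool; true; false; if_then_else_)
open import Data.Product using (_×_)
open import Level using (Level; _⊔_) renaming (suc to lsuc)

-- Truth values of the (n+1)-valued Łukasiewicz chain Ł_n = {0, 1/n, ..., n/n}.
-- The element k : Fin (suc n) represents the real number k/n.
Ł : ℕ → Set
Ł n = Fin (suc n)

clamp : (n : ℕ) → ℕ → Ł n
clamp n k = fromℕ< (s≤s (m⊓n≤n k n))

-- x ⊕ y = min(x + y, 1)  (in units of 1/n: min(a + b, n))
⊕ : (n : ℕ) → Ł n → Ł n → Ł n
⊕ n a b = clamp n (toℕ a + toℕ b)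

-- x ⊙ y = max(x + y - 1, 0)  (in units of 1/n: (a + b) ∸ n)
⊙ : (n : ℕ) → Ł n → Ł n → Ł n
⊙ n a b = clamp n ((toℕ a + toℕ b) ∸ n)

∧ : (n : ℕ) → Ł n → Ł n → Ł n
∧ n a b = clamp n (toℕ a ⊓ toℕ b)

𝟘 : {X : Set} (n : ℕ) → X → Ł n
𝟘 n _ = zero

𝟙 : {X : Set} (n : ℕ) → X → Ł n
𝟙 n _ = fromℕ n

IsPointwiseSup : {X I : Set} (n : ℕ) → (I → X → Ł n) → (X → Ł n) → Set
IsPointwiseSup {X} {I} n g s =
  (x : X) → ((i : I) → g i x ≤ s x) × ((b : Ł n) → ((i : I) → g i x ≤ b) → s x ≤ b)

-- An (n+1)-valued MV-topology on X: a family τ of functions X → Ł_n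
-- (equivalently, a subset of [0,1]^X contained in Ł_n^X) satisfying the axioms.
record IsMVTopology (n : ℕ) (X : Set) (τ : (X → Ł n) → Set) : Set₁ where
  field
    has-0 : τ (𝟘 n)
    has-1 : τ (𝟙 n)
    sup-closed : (I : Set) (g : I → X → Ł n) (s : X → Ł n) →
                 ((i : I) → τ (g i)) → IsPointwiseSup n g s → τ s
    ⊕-closed : (o p : X → Ł n) → τ o → τ p → τ (λ x → ⊕ n (o x) (p x))
    ⊙-closed : (o p : X → Ł n) → τ o → τ p → τ (λ x → ⊙ n (o x) (p x))
    ∧-closed : (o p : X → Ł n) → τ o → τ p → τ (λ x → ∧ n (o x) (p x))

MVContinuous : {n : ℕ} {X Y : Set} → ((X → Ł n) → Set) → ((Y → Ł n) → Set) → (X → Y) → Set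
MVContinuous {n} {X} {Y} τX τY f = (o : Y → Ł n) → τY o → τX (λ x → o (f x))

χ : {X : Set} (n : ℕ) → (X → Bool) → X → Ł n
χ n U x = if U x then fromℕ n else zero

-- skeleton topology j(τ) = τ ∩ {0,1}^X, as a family of subsets of X
skeleton : {n : ℕ} {X : Set} → ((X → Ł n) → Set) → (X → Bool) → Set
skeleton {n} τ U = τ (χ n U)

Continuous : {X Y : Set} → ((X → Bool) → Set) → ((Y → Bool) → Set) → (X → Y) → Set
Continuous {X} {Y} OX OY f = (U : Y → Bool) → OY U → OX (λ x → U (f x))

module Submission where

open import Defs
open import Data.Nat using (ℕ; NonZero)
open import Data.Fin using (Fin)
open import Data.Product using (_×_; Σ; _,_)
open import Function.Bundles using (_↔_)

-- The preimage of a crisp open set U is open in j(X) because χ U ∘ f is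
-- definitionally χ (U ∘ f), and MV-continuity makes the former open in τX.
MVContinuous⇒Continuous-skeleton :
  {n : ℕ} {X Y : Set} (τX : (X → Ł n) → Set) (τY : (Y → Ł n) → Set) (f : X → Y) →
  MVContinuous τX τY f → Continuous (skeleton τX) (skeleton τY) f
MVContinuous⇒Continuous-skeleton {n} τX τY f mv U = mv (χ n U)

MVContinuous-from-discrete :
  {n : ℕ} {X Y : Set} (τX : (X → Ł n) → Set) (τY : (Y → Ł n) → Set) →
  ((o : X → Ł n) → τX o) → (f : X → Y) → MVContinuous τX τY f
MVContinuous-from-discrete τX τY discrete f o _ = discrete (λ x → o (f x))

lemma5p2 : (n : ℕ) → .{{_ : NonZero n}} → {X Y : Set} →
           (τX : (X → Ł n) → Set) → (τY : (Y → Ł n) → Set) →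
           IsMVTopology n X τX → IsMVTopology n Y τY →
           ((f : X → Y) → MVContinuous τX τY f →
             Continuous (skeleton τX) (skeleton τY) f)
           × (Σ ℕ (λ m → X ↔ Fin m) → ((o : X → Ł n) → τX o) →
             (f : X → Y) → Continuous (skeleton τX) (skeleton τY) f →
             MVContinuous τX τY f)
lemma5p2 n τX τY _ _ =
    MVContinuous⇒Continuous-skeleton τX τY
  , λ _ discrete f _ → MVContinuous-from-discrete τX τY discrete f
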